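{- Let $G$ be a non-regular graph on $n$ vertices such that $F_k(G)$ is regular for some $2\le k\le n-2$. Then $G$ is isomorphic to the star $K_{1,n-1}$ or to its complement $\overline{K_{1,n-1}}$, and in both cases $k=n/2$.
   Context: All graphs are finite and simple. For a graph $G=(V,E)$ on $n$ vertices and $1\le k<n$, the $k$-token graph $F_k(G)$ has as vertices the $k$-element subsets of $V$, with $A,B$ adjacent whenever $A\triangle B=\{a,b\}$ for some edge $ab$ of $G$. -}

module Defs where

open import Data.Nat using (ℕ; zero; suc)
open import Data.Bool using (Bool; true; false; _∧_; _∨_; not; if_then_else_)
open import Data.Bool.Properties using () renaming (_≟_ to _≟ᵇ_)
open import Data.Fin using (Fin; toℕ)
open import Data.Fin.Subset using (Subset; ⁅_⁆; _∪_; _─_; ∣_∣)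
open import Data.List using (List; []; _∷_; map; _++_; length; filterᵇ)
open import Data.Bool.ListAction using (any)
open import Data.List.Base using (allFin)
open import Data.Vec using (Vec; []; _∷_)
open import Data.Vec.Properties using (≡-dec)
open import Data.Nat.Base using (_≡ᵇ_)
open import Data.Product using (Σ; ∃; _×_; _,_)
open import Relation.Nullary using (¬_)
open import Relation.Nullary.Decidable using (⌊_⌋)
open import Relation.Binary.PropositionalEquality using (_≡_)
open import Function.Bundles using (_↔_; Inverse)

record Graph (n : ℕ) : Set where
  field
    adj     : Fin n → Fin n → Bool
    symm    : ∀ i j → adj i j ≡ adj j i
    irrefl  : ∀ i → adj i i ≡ false
open Graph public

countᵇ : {A : Set} → (A → Bool) → List A → ℕ
countᵇ p xs = length (filterᵇ p xs)

degree : ∀ {n} → Graph n → Fin n → ℕ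
degree {n} G v = countᵇ (adj G v) (allFin n)

IsRegular : ∀ {n} → Graph n → Set
IsRegular {n} G = ∃ λ d → ∀ (v : Fin n) → degree G v ≡ d

allSubsets : ∀ n → List (Subset n)
allSubsets zero    = [] ∷ []
allSubsets (suc n) = map (false ∷_) (allSubsets n) ++ map (true ∷_) (allSubsets n)

_=ˢ_ : ∀ {n} → Subset n → Subset n → Bool
A =ˢ B = ⌊ ≡-dec _≟ᵇ_ A B ⌋

_△_ : ∀ {n} → Subset n → Subset n → Subset n
A △ B = (A ─ B) ∪ (B ─ A)

-- adjacency in the token graph F_k(G): A △ B = {a, b} for some edge ab of G
tokenAdj : ∀ {n} → Graph n → Subset n → Subset n → Bool
tokenAdj {n} G A B =
  any (λ a → any (λ b → adj G a b ∧ ((A △ B) =ˢ (⁅ a ⁆ ∪ ⁅ b ⁆))) (allFin n)) (allFin n)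

tokenDegree : ∀ {n} → Graph n → (k : ℕ) → Subset n → ℕ
tokenDegree {n} G k A =
  countᵇ (λ B → (∣ B ∣ ≡ᵇ k) ∧ tokenAdj G A B) (allSubsets n)

TokenRegular : ∀ {n} → Graph n → ℕ → Set
TokenRegular {n} G k =
  ∃ λ d → ∀ (A : Subset n) → ∣ A ∣ ≡ k → tokenDegree G k A ≡ d

_≅_ : ∀ {n} → Graph n → Graph n → Set
_≅_ {n} G H = Σ (Fin n ↔ Fin n) λ σ →
  ∀ i j → adj G (Inverse.to σ i) (Inverse.to σ j) ≡ adj H i j

isCentre : ∀ {n} → Fin n → Bool
isCentre i = toℕ i ≡ᵇ 0

starAdj : ∀ {n} → Fin n → Fin n → Bool
starAdj i j = (isCentre i ∧ not (isCentre j)) ∨ (not (isCentre i) ∧ isCentre j)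

private
  isCentre-xor-self : ∀ {n} (i : Fin n) → starAdj i i ≡ false
  isCentre-xor-self i with isCentre i
  ... | true  = _≡_.refl
  ... | false = _≡_.refl

  star-symm : ∀ {n} (i j : Fin n) → starAdj i j ≡ starAdj j i
  star-symm i j with isCentre i | isCentre j
  ... | true  | true  = _≡_.refl
  ... | true  | false = _≡_.refl
  ... | false | true  = _≡_.refl
  ... | false | false = _≡_.refl

star : ∀ n → Graph n
star n = record { adj = starAdj ; symm = star-symm ; irrefl = isCentre-xor-self }

complement : ∀ {n} → Graph n → Graph n
complement {n} G = record
  { adj    = λ i j → not (adj G i j) ∧ not (⌊ i Data.Fin.≟ j ⌋)
  ; symm   = λ i j → symm′ i j
  ; irrefl = λ i → irr i }
  where
  open import Relation.Binary.PropositionalEquality using (refl; sym; cong; cong₂)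
  open import Data.Fin.Properties as FP
  symm′ : ∀ i j → not (adj G i j) ∧ not ⌊ i Data.Fin.≟ j ⌋ ≡ not (adj G j i) ∧ not ⌊ j Data.Fin.≟ i ⌋
  symm′ i j with i FP.≟ j | j FP.≟ i
  ... | Relation.Nullary.yes _ | Relation.Nullary.yes _ = cong (λ x → not x ∧ false) (symm G i j)
  ... | Relation.Nullary.no _  | Relation.Nullary.no _  = cong (λ x → not x ∧ true) (symm G i j)
  ... | Relation.Nullary.yes p | Relation.Nullary.no q  = Data.Empty.⊥-elim (q (sym p))
    where import Data.Empty
  ... | Relation.Nullary.no q  | Relation.Nullary.yes p = Data.Empty.⊥-elim (q (sym p))
    where import Data.Empty
  irr : ∀ i → not (adj G i i) ∧ not ⌊ i Data.Fin.≟ i ⌋ ≡ false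
  irr i with i FP.≟ i
  ... | Relation.Nullary.yes _ = Data.Bool.Properties.∧-zeroʳ _
    where import Data.Bool.Properties
  ... | Relation.Nullary.no q  = Data.Empty.⊥-elim (q refl)
    where import Data.Empty

-- The degree of a k-set A in F_k(G) is the number of edges of G leaving A: every neighbour
-- A △ {a, b} of A arises from exactly one edge ab with a ∈ A and b ∉ A. Adding a vertex u to
-- a set S changes this cut by deg u − 2 e(u, S), where e(u, S) counts the neighbours of u in
-- S, so regularity of F_k(G) gives deg u + 2 e(v, S) = deg v + 2 e(u, S) for every
-- (k − 1)-set S avoiding u and v. Applying this to T ∪ {w} and T ∪ {w′} for a (k − 2)-set T
-- gives [uw] + [vw′] = [vw] + [uw′] for all further vertices w ≠ w′, so if deg u ≠ deg v, one
-- of them, say u, is adjacent to every vertex outside {u, v} and the other to none. Comparing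
-- the degrees of the remaining vertices with deg v then shows that G is the star centred at u
-- when uv is an edge and the complement of the star centred at v otherwise; finally, for a
-- (k − 1)-set S avoiding u and v the balance equation reads (n − 2 + [uv]) + 0 = [uv] + 2 (k − 1),
-- that is n = 2k.

module Submission where

open import Defs
open import Algebra.Properties.CommutativeSemigroup using (x∙yz≈y∙xz)
open import Data.Bool.Base using (Bool; true; false; not; _∧_; _∨_; T)
open import Data.Bool.ListAction using (any)
open import Data.Bool.Properties
  using (∧-zeroʳ; ∨-zeroʳ; ∧-inverseˡ; ∧-inverseʳ; ∨-inverseˡ; ∨-inverseʳ; T-≡; T-∧)
  renaming (_≟_ to _≟ᵇ_)
open import Data.Fin.Base using (Fin; zero; suc; fromℕ<)
open import Data.Fin.Properties using (_≟_; any?; all?; ¬∀⟶∃¬)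
open import Data.Fin.Permutation using (Permutation′; transpose; _⟨$⟩ʳ_)
open import Data.Fin.Subset using (Subset; ⁅_⁆; _∪_; _∩_; ∣_∣; ⊥)
open import Data.Fin.Subset.Properties using (x∈⁅x⁆; x∈⁅y⁆⇒x≡y; ∣⁅x⁆∣≡1; ∣p∣≤∣x∷p∣; ∣⊥∣≡0; ∪-comm)
open import Data.List.Base using ([]; _∷_; _++_; map; allFin; tabulate)
open import Data.List.Membership.Propositional using (lose)
open import Data.List.Membership.Propositional.Properties using (∈-allFin)
open import Data.List.Relation.Unary.Any using (satisfied)
open import Data.List.Relation.Unary.Any.Properties using (any⁺; any⁻)
open import Data.Nat.Base using (ℕ; zero; suc; _+_; _*_; _≤_; _<_; _≡ᵇ_; z≤n; s≤s)
open import Data.Nat.Properties renaming (_≟_ to _≟ℕ_)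
open import Data.Nat.Tactic.RingSolver using (solve-∀)
open import Data.Product.Base using (∃; ∃₂; _×_; _,_; proj₁; proj₂)
open import Data.Sum.Base using (_⊎_; inj₁; inj₂)
open import Data.Vec.Base using ([]; _∷_; lookup)
open import Data.Vec.Properties
  using (lookup-zipWith; []=⇒lookup; lookup⇒[]=; ∷-injectiveˡ; ∷-injectiveʳ; ≡-dec)
open import Function.Base using (_∘_)
open import Function.Bundles using (Equivalence; Injection)
open import Function.Properties.Inverse using (Inverse⇒Injection)
open import Relation.Nullary.Negation using (¬_; contradiction)
open import Relation.Nullary.Decidable
  using (Dec; yes; no; dec-true; dec-false; isYes≗does; decidable-stable; ¬?; _×-dec_; toWitness; fromWitness)
open import Relation.Binary.PropositionalEquality

open import Algebra.Properties.Semiring.Sum +-*-semiring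
  using (sum; sum-syntax; sum-cong-≗; sum-replicate-zero; ∑-distrib-+; ∑-comm; *-distribˡ-sum)

private
  variable
    n : ℕ

𝟙 : Bool → ℕ
𝟙 true  = 1
𝟙 false = 0

𝟙-∧ : ∀ x y → 𝟙 (x ∧ y) ≡ 𝟙 x * 𝟙 y
𝟙-∧ true  y = sym (+-identityʳ (𝟙 y))
𝟙-∧ false y = refl

𝟙-∨ : ∀ x y → x ∧ y ≡ false → 𝟙 (x ∨ y) ≡ 𝟙 x + 𝟙 y
𝟙-∨ true  true  ()
𝟙-∨ true  false _ = refl
𝟙-∨ false y     _ = refl

∧-true⇒ : ∀ {x y} → x ∧ y ≡ true → x ≡ true × y ≡ true
∧-true⇒ {true} {true} _ = refl , refl

𝟙+𝟙≡1⇒ : ∀ x y → 𝟙 x + 𝟙 y ≡ 1 → (x ≡ true × y ≡ false) ⊎ (x ≡ false × y ≡ true)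
𝟙+𝟙≡1⇒ true  false _ = inj₁ (refl , refl)
𝟙+𝟙≡1⇒ false true  _ = inj₂ (refl , refl)
𝟙+𝟙≡1⇒ true  true  ()
𝟙+𝟙≡1⇒ false false ()

∑-zero : {f : Fin n → ℕ} → (∀ i → f i ≡ 0) → sum f ≡ 0
∑-zero {n} f≗0 = trans (sum-cong-≗ f≗0) (sum-replicate-zero n)

∑-one : ∀ n → ∑[ i < n ] 1 ≡ n
∑-one zero    = refl
∑-one (suc n) = cong suc (∑-one n)

∑-mono-≤ : {f g : Fin n → ℕ} → (∀ i → f i ≤ g i) → sum f ≤ sum g
∑-mono-≤ {zero}  f≤g = z≤n
∑-mono-≤ {suc n} f≤g = +-mono-≤ (f≤g zero) (∑-mono-≤ (f≤g ∘ suc))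

lookup-⊥ : ∀ (i : Fin n) → lookup ⊥ i ≡ false
lookup-⊥ zero    = refl
lookup-⊥ (suc i) = lookup-⊥ i

lookup-⁅⁆-self : ∀ (u : Fin n) → lookup ⁅ u ⁆ u ≡ true
lookup-⁅⁆-self u = []=⇒lookup (x∈⁅x⁆ u)

lookup-⁅⁆⇒≡ : ∀ {i u : Fin n} → lookup ⁅ u ⁆ i ≡ true → i ≡ u
lookup-⁅⁆⇒≡ {i = i} {u} eq = x∈⁅y⁆⇒x≡y u (lookup⇒[]= i ⁅ u ⁆ eq)

lookup-⁅⁆-≢ : ∀ {i u : Fin n} → i ≢ u → lookup ⁅ u ⁆ i ≡ false
lookup-⁅⁆-≢ {i = i} {u} i≢u with lookup ⁅ u ⁆ i in eq
... | true  = contradiction (lookup-⁅⁆⇒≡ eq) i≢u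
... | false = refl

∉⇒disjoint-⁅⁆ : ∀ (X : Fin n → Bool) {u} → X u ≡ false → ∀ i → X i ∧ lookup ⁅ u ⁆ i ≡ false
∉⇒disjoint-⁅⁆ X {u} Xu≡false i with i ≟ u
... | yes refl rewrite Xu≡false = refl
... | no  i≢u  = trans (cong (X i ∧_) (lookup-⁅⁆-≢ i≢u)) (∧-zeroʳ (X i))

∑-δ : ∀ (u : Fin n) (f : Fin n → ℕ) → ∑[ i < n ] (𝟙 (lookup ⁅ u ⁆ i) * f i) ≡ f u
∑-δ {suc n} zero    f = trans
  (cong₂ _+_ (*-identityˡ (f zero)) (∑-zero λ i → cong (λ b → 𝟙 b * f (suc i)) (lookup-⊥ i)))
  (+-identityʳ (f zero))
∑-δ {suc n} (suc u) f = ∑-δ u (f ∘ suc)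

∑-concentrated : ∀ (u : Fin n) {f : Fin n → ℕ} → (∀ i → i ≢ u → f i ≡ 0) → sum f ≡ f u
∑-concentrated u {f} vanish = trans (sum-cong-≗ δ-form) (∑-δ u f)
  where
  δ-form : ∀ i → f i ≡ 𝟙 (lookup ⁅ u ⁆ i) * f i
  δ-form i with i ≟ u
  ... | yes refl rewrite lookup-⁅⁆-self i = sym (*-identityˡ (f i))
  ... | no  i≢u  rewrite lookup-⁅⁆-≢ i≢u   = vanish i i≢u

⁅⁆-disjoint : ∀ {a b : Fin n} → a ≢ b → ∀ i → lookup ⁅ a ⁆ i ∧ lookup ⁅ b ⁆ i ≡ false
⁅⁆-disjoint {a = a} a≢b = ∉⇒disjoint-⁅⁆ (lookup ⁅ a ⁆) (lookup-⁅⁆-≢ (a≢b ∘ sym))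

∑-pair : ∀ {a b : Fin n} → a ≢ b → (f : Fin n → ℕ) →
         ∑[ i < n ] (𝟙 (lookup ⁅ a ⁆ i ∨ lookup ⁅ b ⁆ i) * f i) ≡ f a + f b
∑-pair {n} {a} {b} a≢b f = begin
  ∑[ i < n ] (𝟙 (δa i ∨ δb i) * f i)
    ≡⟨ sum-cong-≗ split ⟩
  ∑[ i < n ] (𝟙 (δa i) * f i + 𝟙 (δb i) * f i)
    ≡⟨ ∑-distrib-+ (λ i → 𝟙 (δa i) * f i) (λ i → 𝟙 (δb i) * f i) ⟩
  ∑[ i < n ] (𝟙 (δa i) * f i) + ∑[ i < n ] (𝟙 (δb i) * f i)
    ≡⟨ cong₂ _+_ (∑-δ a f) (∑-δ b f) ⟩
  f a + f b ∎
  where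
  open ≡-Reasoning
  δa δb : Fin n → Bool
  δa = lookup ⁅ a ⁆
  δb = lookup ⁅ b ⁆
  split : ∀ i → 𝟙 (δa i ∨ δb i) * f i ≡ 𝟙 (δa i) * f i + 𝟙 (δb i) * f i
  split i rewrite 𝟙-∨ (δa i) (δb i) (⁅⁆-disjoint a≢b i) = *-distribʳ-+ (f i) (𝟙 (δa i)) (𝟙 (δb i))

lookup-∪ : ∀ (p q : Subset n) i → lookup (p ∪ q) i ≡ lookup p i ∨ lookup q i
lookup-∪ p q i = lookup-zipWith _∨_ i p q

lookup-∩ : ∀ (p q : Subset n) i → lookup (p ∩ q) i ≡ lookup p i ∧ lookup q i
lookup-∩ p q i = lookup-zipWith _∧_ i p q

∣p∣≡∑𝟙 : ∀ (p : Subset n) → ∣ p ∣ ≡ ∑[ i < n ] 𝟙 (lookup p i)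
∣p∣≡∑𝟙 []          = refl
∣p∣≡∑𝟙 (true  ∷ p) = cong suc (∣p∣≡∑𝟙 p)
∣p∣≡∑𝟙 (false ∷ p) = ∣p∣≡∑𝟙 p

∣p∪q∣≡∣p∣+∣q∣ : ∀ (p q : Subset n) → (∀ i → lookup p i ∧ lookup q i ≡ false) →
                ∣ p ∪ q ∣ ≡ ∣ p ∣ + ∣ q ∣
∣p∪q∣≡∣p∣+∣q∣ {n} p q disjoint = begin
  ∣ p ∪ q ∣
    ≡⟨ ∣p∣≡∑𝟙 (p ∪ q) ⟩
  ∑[ i < n ] 𝟙 (lookup (p ∪ q) i)
    ≡⟨ sum-cong-≗ split ⟩
  ∑[ i < n ] (𝟙 (lookup p i) + 𝟙 (lookup q i))
    ≡⟨ ∑-distrib-+ (𝟙 ∘ lookup p) (𝟙 ∘ lookup q) ⟩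
  ∑[ i < n ] 𝟙 (lookup p i) + ∑[ i < n ] 𝟙 (lookup q i)
    ≡⟨ sym (cong₂ _+_ (∣p∣≡∑𝟙 p) (∣p∣≡∑𝟙 q)) ⟩
  ∣ p ∣ + ∣ q ∣ ∎
  where
  open ≡-Reasoning
  split : ∀ i → 𝟙 (lookup (p ∪ q) i) ≡ 𝟙 (lookup p i) + 𝟙 (lookup q i)
  split i rewrite lookup-∪ p q i = 𝟙-∨ (lookup p i) (lookup q i) (disjoint i)

∣p∪⁅x⁆∣≡1+∣p∣ : ∀ (p : Subset n) {x} → lookup p x ≡ false → ∣ p ∪ ⁅ x ⁆ ∣ ≡ suc ∣ p ∣
∣p∪⁅x⁆∣≡1+∣p∣ p {x} x∉p = begin
  ∣ p ∪ ⁅ x ⁆ ∣       ≡⟨ ∣p∪q∣≡∣p∣+∣q∣ p ⁅ x ⁆ (∉⇒disjoint-⁅⁆ (lookup p) x∉p) ⟩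
  ∣ p ∣ + ∣ ⁅ x ⁆ ∣   ≡⟨ cong (∣ p ∣ +_) (∣⁅x⁆∣≡1 x) ⟩
  ∣ p ∣ + 1           ≡⟨ +-comm ∣ p ∣ 1 ⟩
  suc ∣ p ∣ ∎
  where open ≡-Reasoning

∣p∪q∣≤∣p∣+∣q∣ : ∀ (p q : Subset n) → ∣ p ∪ q ∣ ≤ ∣ p ∣ + ∣ q ∣
∣p∪q∣≤∣p∣+∣q∣ []          []          = z≤n
∣p∪q∣≤∣p∣+∣q∣ (true  ∷ p) (y     ∷ q) =
  s≤s (≤-trans (∣p∪q∣≤∣p∣+∣q∣ p q) (+-monoʳ-≤ ∣ p ∣ (∣p∣≤∣x∷p∣ y q)))
∣p∪q∣≤∣p∣+∣q∣ (false ∷ p) (true  ∷ q) =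
  subst (suc ∣ p ∪ q ∣ ≤_) (sym (+-suc ∣ p ∣ ∣ q ∣)) (s≤s (∣p∪q∣≤∣p∣+∣q∣ p q))
∣p∪q∣≤∣p∣+∣q∣ (false ∷ p) (false ∷ q) = ∣p∪q∣≤∣p∣+∣q∣ p q

△-cancelˡ : ∀ (A C : Subset n) → A △ (A △ C) ≡ C
△-cancelˡ []          []          = refl
△-cancelˡ (true  ∷ A) (true  ∷ C) = cong (true  ∷_) (△-cancelˡ A C)
△-cancelˡ (true  ∷ A) (false ∷ C) = cong (false ∷_) (△-cancelˡ A C)
△-cancelˡ (false ∷ A) (true  ∷ C) = cong (true  ∷_) (△-cancelˡ A C)
△-cancelˡ (false ∷ A) (false ∷ C) = cong (false ∷_) (△-cancelˡ A C)

△-solve : ∀ {A B C : Subset n} → A △ B ≡ C → B ≡ A △ C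
△-solve {A = A} {B} refl = sym (△-cancelˡ A B)

∣p△q∣+2∣p∩q∣≡∣p∣+∣q∣ : ∀ (p q : Subset n) → ∣ p △ q ∣ + 2 * ∣ p ∩ q ∣ ≡ ∣ p ∣ + ∣ q ∣
∣p△q∣+2∣p∩q∣≡∣p∣+∣q∣ []          []          = refl
∣p△q∣+2∣p∩q∣≡∣p∣+∣q∣ (true  ∷ p) (true  ∷ q) = begin
  ∣ p △ q ∣ + 2 * suc ∣ p ∩ q ∣         ≡⟨ cong (∣ p △ q ∣ +_) (*-suc 2 ∣ p ∩ q ∣) ⟩
  ∣ p △ q ∣ + (2 + 2 * ∣ p ∩ q ∣)       ≡⟨ +-suc ∣ p △ q ∣ _ ⟩
  suc (∣ p △ q ∣ + suc (2 * ∣ p ∩ q ∣)) ≡⟨ cong suc (+-suc ∣ p △ q ∣ _) ⟩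
  2 + (∣ p △ q ∣ + 2 * ∣ p ∩ q ∣)       ≡⟨ cong (2 +_) (∣p△q∣+2∣p∩q∣≡∣p∣+∣q∣ p q) ⟩
  2 + (∣ p ∣ + ∣ q ∣)                   ≡⟨ cong suc (sym (+-suc ∣ p ∣ ∣ q ∣)) ⟩
  suc ∣ p ∣ + suc ∣ q ∣ ∎
  where open ≡-Reasoning
∣p△q∣+2∣p∩q∣≡∣p∣+∣q∣ (true  ∷ p) (false ∷ q) = cong suc (∣p△q∣+2∣p∩q∣≡∣p∣+∣q∣ p q)
∣p△q∣+2∣p∩q∣≡∣p∣+∣q∣ (false ∷ p) (true  ∷ q) =
  trans (cong suc (∣p△q∣+2∣p∩q∣≡∣p∣+∣q∣ p q)) (sym (+-suc ∣ p ∣ ∣ q ∣))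
∣p△q∣+2∣p∩q∣≡∣p∣+∣q∣ (false ∷ p) (false ∷ q) = ∣p△q∣+2∣p∩q∣≡∣p∣+∣q∣ p q

∪-∋ˡ : ∀ (p q : Subset n) {i} → lookup p i ≡ true → lookup (p ∪ q) i ≡ true
∪-∋ˡ p q {i} i∈p = trans (lookup-∪ p q i) (cong (_∨ lookup q i) i∈p)

∪-∋ʳ : ∀ (p q : Subset n) {i} → lookup q i ≡ true → lookup (p ∪ q) i ≡ true
∪-∋ʳ p q {i} i∈q = trans (lookup-∪ p q i) (trans (cong (lookup p i ∨_) i∈q) (∨-zeroʳ (lookup p i)))

∪⁅⁆-∌ : ∀ (p : Subset n) {i x} → lookup p i ≡ false → i ≢ x → lookup (p ∪ ⁅ x ⁆) i ≡ false
∪⁅⁆-∌ p {i} {x} i∉p i≢x = trans (lookup-∪ p ⁅ x ⁆ i) (cong₂ _∨_ i∉p (lookup-⁅⁆-≢ i≢x))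

∈∉⇒≢ : ∀ (p : Subset n) {i j} → lookup p i ≡ true → lookup p j ≡ false → i ≢ j
∈∉⇒≢ p i∈p j∉p refl with () ← trans (sym i∈p) j∉p

∣⁅x⁆∪p∣≤1+∣p∣ : ∀ x (p : Subset n) → ∣ ⁅ x ⁆ ∪ p ∣ ≤ suc ∣ p ∣
∣⁅x⁆∪p∣≤1+∣p∣ x p = subst (λ s → ∣ ⁅ x ⁆ ∪ p ∣ ≤ s + ∣ p ∣) (∣⁅x⁆∣≡1 x) (∣p∪q∣≤∣p∣+∣q∣ ⁅ x ⁆ p)

∣⁅u⁆∪⁅v⁆∣≤2 : ∀ (u v : Fin n) → ∣ ⁅ u ⁆ ∪ ⁅ v ⁆ ∣ ≤ 2
∣⁅u⁆∪⁅v⁆∣≤2 u v = subst (λ s → ∣ ⁅ u ⁆ ∪ ⁅ v ⁆ ∣ ≤ suc s) (∣⁅x⁆∣≡1 v) (∣⁅x⁆∪p∣≤1+∣p∣ u ⁅ v ⁆)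

∣⁅u⁆∪⁅v⁆∪⁅w⁆∪⁅w′⁆∣≤4 : ∀ (u v w w′ : Fin n) → ∣ ⁅ u ⁆ ∪ ⁅ v ⁆ ∪ ⁅ w ⁆ ∪ ⁅ w′ ⁆ ∣ ≤ 4
∣⁅u⁆∪⁅v⁆∪⁅w⁆∪⁅w′⁆∣≤4 u v w w′ =
  ≤-trans (∣⁅x⁆∪p∣≤1+∣p∣ u _) (s≤s (≤-trans (∣⁅x⁆∪p∣≤1+∣p∣ v _) (s≤s (∣⁅u⁆∪⁅v⁆∣≤2 w w′))))

∃-avoiding : ∀ m (F : Subset n) → m + ∣ F ∣ ≤ n →
             ∃ λ S → ∣ S ∣ ≡ m × (∀ i → lookup F i ≡ true → lookup S i ≡ false)
∃-avoiding {n} zero F _ = ⊥ , ∣⊥∣≡0 n , λ i _ → lookup-⊥ i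
∃-avoiding {suc n} (suc m) (true  ∷ F) room
  with S , ∣S∣ , avoids ← ∃-avoiding (suc m) F (≤-pred (subst (_≤ suc n) (+-suc (suc m) ∣ F ∣) room))
  = false ∷ S , ∣S∣ , λ { zero _ → refl ; (suc i) i∈F → avoids i i∈F }
∃-avoiding (suc m) (false ∷ F) (s≤s room)
  with S , ∣S∣ , avoids ← ∃-avoiding m F room
  = true ∷ S , cong suc ∣S∣ , λ { zero () ; (suc i) i∈F → avoids i i∈F }

=ˢ-true : ∀ {A B : Subset n} → A ≡ B → (A =ˢ B) ≡ true
=ˢ-true {A = A} {B} A≡B = trans (isYes≗does (≡-dec _≟ᵇ_ A B)) (dec-true (≡-dec _≟ᵇ_ A B) A≡B)

=ˢ-false : ∀ {A B : Subset n} → A ≢ B → (A =ˢ B) ≡ false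
=ˢ-false {A = A} {B} A≢B = trans (isYes≗does (≡-dec _≟ᵇ_ A B)) (dec-false (≡-dec _≟ᵇ_ A B) A≢B)

=ˢ⇒≡ : ∀ {A B : Subset n} → (A =ˢ B) ≡ true → A ≡ B
=ˢ⇒≡ eq = toWitness (Equivalence.from T-≡ eq)

=ˢ-∷ : ∀ x (B C : Subset n) → ((x ∷ B) =ˢ (x ∷ C)) ≡ (B =ˢ C)
=ˢ-∷ x B C = by-cases (≡-dec _≟ᵇ_ B C)
  where
  by-cases : Dec (B ≡ C) → ((x ∷ B) =ˢ (x ∷ C)) ≡ (B =ˢ C)
  by-cases (yes B≡C) = trans (=ˢ-true (cong (x ∷_) B≡C)) (sym (=ˢ-true B≡C))
  by-cases (no  B≢C) = trans (=ˢ-false (B≢C ∘ ∷-injectiveʳ)) (sym (=ˢ-false B≢C))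

countᵇ-∷ : ∀ {A : Set} (p : A → Bool) x xs → countᵇ p (x ∷ xs) ≡ 𝟙 (p x) + countᵇ p xs
countᵇ-∷ p x xs with p x
... | true  = refl
... | false = refl

countᵇ-++ : ∀ {A : Set} (p : A → Bool) xs ys → countᵇ p (xs ++ ys) ≡ countᵇ p xs + countᵇ p ys
countᵇ-++ p []       ys = refl
countᵇ-++ p (x ∷ xs) ys = begin
  countᵇ p (x ∷ xs ++ ys)                ≡⟨ countᵇ-∷ p x (xs ++ ys) ⟩
  𝟙 (p x) + countᵇ p (xs ++ ys)          ≡⟨ cong (𝟙 (p x) +_) (countᵇ-++ p xs ys) ⟩
  𝟙 (p x) + (countᵇ p xs + countᵇ p ys)  ≡⟨ sym (+-assoc (𝟙 (p x)) _ _) ⟩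
  (𝟙 (p x) + countᵇ p xs) + countᵇ p ys  ≡⟨ cong (_+ countᵇ p ys) (sym (countᵇ-∷ p x xs)) ⟩
  countᵇ p (x ∷ xs) + countᵇ p ys ∎
  where open ≡-Reasoning

countᵇ-map : ∀ {A B : Set} (p : B → Bool) (f : A → B) xs → countᵇ p (map f xs) ≡ countᵇ (p ∘ f) xs
countᵇ-map p f []       = refl
countᵇ-map p f (x ∷ xs) =
  trans (countᵇ-∷ p (f x) (map f xs))
        (trans (cong (𝟙 (p (f x)) +_) (countᵇ-map p f xs)) (sym (countᵇ-∷ (p ∘ f) x xs)))

countᵇ-cong : ∀ {A : Set} {p q : A → Bool} → (∀ x → p x ≡ q x) → ∀ xs → countᵇ p xs ≡ countᵇ q xs
countᵇ-cong p≗q []       = refl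
countᵇ-cong {p = p} {q} p≗q (x ∷ xs) =
  trans (countᵇ-∷ p x xs)
        (trans (cong₂ _+_ (cong 𝟙 (p≗q x)) (countᵇ-cong p≗q xs)) (sym (countᵇ-∷ q x xs)))

countᵇ-none : ∀ {A : Set} {p : A → Bool} → (∀ x → p x ≡ false) → ∀ xs → countᵇ p xs ≡ 0
countᵇ-none p≗false []       = refl
countᵇ-none {p = p} p≗false (x ∷ xs) =
  trans (countᵇ-∷ p x xs) (cong₂ _+_ (cong 𝟙 (p≗false x)) (countᵇ-none p≗false xs))

countᵇ-tabulate : ∀ {A : Set} (p : A → Bool) (f : Fin n → A) →
                  countᵇ p (tabulate f) ≡ ∑[ i < n ] 𝟙 (p (f i))
countᵇ-tabulate {zero}  p f = refl
countᵇ-tabulate {suc n} p f =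
  trans (countᵇ-∷ p (f zero) _) (cong (𝟙 (p (f zero)) +_) (countᵇ-tabulate p (f ∘ suc)))

countᵇ-allSubsets : ∀ (C : Subset n) → countᵇ (_=ˢ C) (allSubsets n) ≡ 1
countᵇ-allSubsets []      = refl
countᵇ-allSubsets {suc n} (c ∷ C) = begin
  countᵇ (_=ˢ (c ∷ C)) (map (false ∷_) L ++ map (true ∷_) L)
    ≡⟨ countᵇ-++ (_=ˢ (c ∷ C)) (map (false ∷_) L) _ ⟩
  countᵇ (_=ˢ (c ∷ C)) (map (false ∷_) L) + countᵇ (_=ˢ (c ∷ C)) (map (true ∷_) L)
    ≡⟨ cong₂ _+_ (countᵇ-map (_=ˢ (c ∷ C)) (false ∷_) L) (countᵇ-map (_=ˢ (c ∷ C)) (true ∷_) L) ⟩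
  countᵇ (λ B → (false ∷ B) =ˢ (c ∷ C)) L + countᵇ (λ B → (true ∷ B) =ˢ (c ∷ C)) L
    ≡⟨ one-head-matches c ⟩
  1 ∎
  where
  open ≡-Reasoning
  L = allSubsets n
  matching : ∀ x → countᵇ (λ B → (x ∷ B) =ˢ (x ∷ C)) L ≡ 1
  matching x = trans (countᵇ-cong (λ B → =ˢ-∷ x B C) L) (countᵇ-allSubsets C)
  mismatching : ∀ {x y} → x ≢ y → countᵇ (λ B → (x ∷ B) =ˢ (y ∷ C)) L ≡ 0
  mismatching x≢y = countᵇ-none (λ B → =ˢ-false (x≢y ∘ ∷-injectiveˡ)) L
  one-head-matches : ∀ y →
    countᵇ (λ B → (false ∷ B) =ˢ (y ∷ C)) L + countᵇ (λ B → (true ∷ B) =ˢ (y ∷ C)) L ≡ 1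
  one-head-matches false = cong₂ _+_ (matching false) (mismatching {true} {false} λ ())
  one-head-matches true  = cong₂ _+_ (mismatching {false} {true} λ ()) (matching true)

countᵇ-by-pairs : ∀ {X : Set} (P : X → Bool) (w : Fin n → Fin n → ℕ) (Q : Fin n → Fin n → X → Bool) →
                  (∀ x → 𝟙 (P x) ≡ ∑[ a < n ] ∑[ b < n ] (w a b * 𝟙 (Q a b x))) →
                  ∀ xs → countᵇ P xs ≡ ∑[ a < n ] ∑[ b < n ] (w a b * countᵇ (Q a b) xs)
countᵇ-by-pairs P w Q P≡ [] = sym (∑-zero λ a → ∑-zero λ b → *-zeroʳ (w a b))
countᵇ-by-pairs {n} P w Q P≡ (x ∷ xs) = begin
  countᵇ P (x ∷ xs)
    ≡⟨ countᵇ-∷ P x xs ⟩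
  𝟙 (P x) + countᵇ P xs
    ≡⟨ cong₂ _+_ (P≡ x) (countᵇ-by-pairs P w Q P≡ xs) ⟩
  ∑[ a < n ] ∑[ b < n ] here a b + ∑[ a < n ] ∑[ b < n ] later a b
    ≡⟨ sym (∑-distrib-+ (λ a → ∑[ b < n ] here a b) _) ⟩
  ∑[ a < n ] (∑[ b < n ] here a b + ∑[ b < n ] later a b)
    ≡⟨ sum-cong-≗ (λ a → sym (∑-distrib-+ (here a) (later a))) ⟩
  ∑[ a < n ] ∑[ b < n ] (here a b + later a b)
    ≡⟨ sum-cong-≗ (λ a → sum-cong-≗ (λ b → step a b)) ⟩
  ∑[ a < n ] ∑[ b < n ] (w a b * countᵇ (Q a b) (x ∷ xs)) ∎
  where
  open ≡-Reasoning
  here later : Fin n → Fin n → ℕ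
  here  a b = w a b * 𝟙 (Q a b x)
  later a b = w a b * countᵇ (Q a b) xs
  step : ∀ a b → here a b + later a b ≡ w a b * countᵇ (Q a b) (x ∷ xs)
  step a b = trans (sym (*-distribˡ-+ (w a b) _ _)) (cong (w a b *_) (sym (countᵇ-∷ (Q a b) x xs)))

-- Moving a token along an edge

move : Subset n → Fin n → Fin n → Subset n
move A a b = A △ (⁅ a ⁆ ∪ ⁅ b ⁆)

move-comm : ∀ (A : Subset n) a b → move A a b ≡ move A b a
move-comm A a b = cong (A △_) (∪-comm ⁅ a ⁆ ⁅ b ⁆)

∈⁅a⁆∪⁅b⁆ : ∀ {a b i : Fin n} → lookup (⁅ a ⁆ ∪ ⁅ b ⁆) i ≡ true → i ≡ a ⊎ i ≡ b
∈⁅a⁆∪⁅b⁆ {a = a} {b} {i} i∈ rewrite lookup-∪ ⁅ a ⁆ ⁅ b ⁆ i with lookup ⁅ a ⁆ i in i∈a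
... | true  = inj₁ (lookup-⁅⁆⇒≡ i∈a)
... | false = inj₂ (lookup-⁅⁆⇒≡ i∈)

∣move∣ : ∀ (A : Subset n) {a b} → a ≢ b →
         ∣ move A a b ∣ + 2 * (𝟙 (lookup A a) + 𝟙 (lookup A b)) ≡ ∣ A ∣ + 2
∣move∣ A {a} {b} a≢b = begin
  ∣ move A a b ∣ + 2 * (𝟙 (lookup A a) + 𝟙 (lookup A b))
    ≡⟨ cong (λ m → ∣ move A a b ∣ + 2 * m) (sym ∣A∩C∣) ⟩
  ∣ A △ C ∣ + 2 * ∣ A ∩ C ∣
    ≡⟨ ∣p△q∣+2∣p∩q∣≡∣p∣+∣q∣ A C ⟩
  ∣ A ∣ + ∣ C ∣
    ≡⟨ cong (∣ A ∣ +_) ∣C∣ ⟩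
  ∣ A ∣ + 2 ∎
  where
  open ≡-Reasoning
  C = ⁅ a ⁆ ∪ ⁅ b ⁆
  ∣C∣ : ∣ C ∣ ≡ 2
  ∣C∣ = trans (∣p∪q∣≡∣p∣+∣q∣ ⁅ a ⁆ ⁅ b ⁆ (⁅⁆-disjoint a≢b)) (cong₂ _+_ (∣⁅x⁆∣≡1 a) (∣⁅x⁆∣≡1 b))
  pointwise : ∀ i → 𝟙 (lookup (A ∩ C) i) ≡ 𝟙 (lookup ⁅ a ⁆ i ∨ lookup ⁅ b ⁆ i) * 𝟙 (lookup A i)
  pointwise i rewrite lookup-∩ A C i | lookup-∪ ⁅ a ⁆ ⁅ b ⁆ i =
    trans (𝟙-∧ (lookup A i) _) (*-comm (𝟙 (lookup A i)) _)
  ∣A∩C∣ : ∣ A ∩ C ∣ ≡ 𝟙 (lookup A a) + 𝟙 (lookup A b)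
  ∣A∩C∣ = trans (∣p∣≡∑𝟙 (A ∩ C)) (trans (sum-cong-≗ pointwise) (∑-pair a≢b (𝟙 ∘ lookup A)))

-- Token neighbours and edge cuts

module _ (G : Graph n) where

  adj⇒≢ : ∀ {a b} → adj G a b ≡ true → a ≢ b
  adj⇒≢ {a} ab refl with () ← trans (sym ab) (irrefl G a)

  tokenAdj⇒move : ∀ A B → tokenAdj G A B ≡ true → ∃₂ λ a b → adj G a b ≡ true × B ≡ move A a b
  tokenAdj⇒move A B adjacent =
    a , b , Equivalence.to T-≡ ab , △-solve (toWitness {a? = ≡-dec _≟ᵇ_ (A △ B) (⁅ a ⁆ ∪ ⁅ b ⁆)} moves)
    where
    moves-along : Fin n → Fin n → Bool
    moves-along a b = adj G a b ∧ ((A △ B) =ˢ (⁅ a ⁆ ∪ ⁅ b ⁆))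
    a-found : ∃ λ a → T (any (moves-along a) (allFin n))
    a-found = satisfied (any⁻ _ (allFin n) (Equivalence.from T-≡ adjacent))
    a = proj₁ a-found
    b-found : ∃ λ b → T (moves-along a b)
    b-found = satisfied (any⁻ _ (allFin n) (proj₂ a-found))
    b = proj₁ b-found
    found-edge : T (adj G a b) × T ((A △ B) =ˢ (⁅ a ⁆ ∪ ⁅ b ⁆))
    found-edge = Equivalence.to (T-∧ {adj G a b}) (proj₂ b-found)
    ab = proj₁ found-edge
    moves = proj₂ found-edge

  move⇒tokenAdj : ∀ A {a b} → adj G a b ≡ true → tokenAdj G A (move A a b) ≡ true
  move⇒tokenAdj A {a} {b} ab = Equivalence.to T-≡
    (any⁺ _ (lose (∈-allFin a) (any⁺ _ (lose (∈-allFin b)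
      (Equivalence.from T-∧ (Equivalence.from T-≡ ab , fromWitness (△-cancelˡ A (⁅ a ⁆ ∪ ⁅ b ⁆))))))))

  crossing : Subset n → Fin n → Fin n → Bool
  crossing A a b = lookup A a ∧ not (lookup A b) ∧ adj G a b

  crossing⇒ : ∀ A {a b} → crossing A a b ≡ true →
              lookup A a ≡ true × lookup A b ≡ false × adj G a b ≡ true
  crossing⇒ A {a} {b} c = split (lookup A a) (lookup A b) (adj G a b) c
    where
    split : ∀ x y z → x ∧ not y ∧ z ≡ true → x ≡ true × y ≡ false × z ≡ true
    split true  false true  _ = refl , refl , refl
    split true  true  _     ()
    split true  false false ()
    split false _     _     ()

  crossing⇒∣move∣ : ∀ A {a b} → crossing A a b ≡ true → ∣ move A a b ∣ ≡ ∣ A ∣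
  crossing⇒∣move∣ A {a} {b} c with crossing⇒ A c
  ... | a∈A , b∉A , ab = +-cancelʳ-≡ 2 _ _
    (subst (λ s → ∣ move A a b ∣ + 2 * s ≡ ∣ A ∣ + 2) (cong₂ _+_ (cong 𝟙 a∈A) (cong 𝟙 b∉A))
           (∣move∣ A (adj⇒≢ ab)))

  ∣move∣≡⇒crossing : ∀ A {a b} → adj G a b ≡ true → ∣ move A a b ∣ ≡ ∣ A ∣ →
                     crossing A a b ≡ true ⊎ crossing A b a ≡ true
  ∣move∣≡⇒crossing A {a} {b} ab same-size
    with 𝟙+𝟙≡1⇒ (lookup A a) (lookup A b) (*-cancelˡ-≡ _ 1 2 (+-cancelˡ-≡ ∣ A ∣ _ _ size-equation))
    where
    size-equation : ∣ A ∣ + 2 * (𝟙 (lookup A a) + 𝟙 (lookup A b)) ≡ ∣ A ∣ + 2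
    size-equation =
      subst (λ m → m + 2 * (𝟙 (lookup A a) + 𝟙 (lookup A b)) ≡ ∣ A ∣ + 2) same-size (∣move∣ A (adj⇒≢ ab))
  ... | inj₁ (a∈A , b∉A) rewrite a∈A | b∉A = inj₁ ab
  ... | inj₂ (a∉A , b∈A) rewrite a∉A | b∈A = inj₂ (trans (symm G b a) ab)

  crossing-move-injective : ∀ A {a b a′ b′} → crossing A a b ≡ true → crossing A a′ b′ ≡ true →
                            move A a′ b′ ≡ move A a b → a′ ≡ a × b′ ≡ b
  crossing-move-injective A {a} {b} {a′} {b′} c c′ same-move
    with crossing⇒ A c | crossing⇒ A c′
  ... | a∈A , b∉A , _ | a′∈A , b′∉A , _ = source , target
    where
    same-pair : ⁅ a′ ⁆ ∪ ⁅ b′ ⁆ ≡ ⁅ a ⁆ ∪ ⁅ b ⁆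
    same-pair = trans (sym (△-cancelˡ A _)) (trans (cong (A △_) same-move) (△-cancelˡ A _))
    in-pair : ∀ {i} → lookup (⁅ a′ ⁆ ∪ ⁅ b′ ⁆) i ≡ true → i ≡ a ⊎ i ≡ b
    in-pair i∈ = ∈⁅a⁆∪⁅b⁆ (trans (cong (λ C → lookup C _) (sym same-pair)) i∈)
    source : a′ ≡ a
    source with in-pair (∪-∋ˡ ⁅ a′ ⁆ ⁅ b′ ⁆ (lookup-⁅⁆-self a′))
    ... | inj₁ a′≡a = a′≡a
    ... | inj₂ refl with () ← trans (sym a′∈A) b∉A
    target : b′ ≡ b
    target with in-pair (∪-∋ʳ ⁅ a′ ⁆ ⁅ b′ ⁆ (lookup-⁅⁆-self b′))
    ... | inj₁ refl with () ← trans (sym a∈A) b′∉A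
    ... | inj₂ b′≡b = b′≡b

  move-term-vanishes : ∀ A B a b → (crossing A a b ≡ true → B ≢ move A a b) →
                       𝟙 (crossing A a b) * 𝟙 (B =ˢ move A a b) ≡ 0
  move-term-vanishes A B a b ¬moves with crossing A a b | B =ˢ move A a b in e
  ... | false | _     = refl
  ... | true  | false = refl
  ... | true  | true  = contradiction (=ˢ⇒≡ e) (¬moves refl)

  move-terms-concentrated : ∀ A B {a b} → crossing A a b ≡ true → B ≡ move A a b →
    ∑[ a′ < n ] ∑[ b′ < n ] (𝟙 (crossing A a′ b′) * 𝟙 (B =ˢ move A a′ b′)) ≡ 1
  move-terms-concentrated A B {a} {b} c B≡ = begin
    ∑[ a′ < n ] ∑[ b′ < n ] term a′ b′ ≡⟨ ∑-concentrated a other-source ⟩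
    ∑[ b′ < n ] term a b′              ≡⟨ ∑-concentrated b other-target ⟩
    term a b                           ≡⟨ cong₂ (λ x y → 𝟙 x * 𝟙 y) c (=ˢ-true B≡) ⟩
    1 ∎
    where
    open ≡-Reasoning
    term : Fin n → Fin n → ℕ
    term a′ b′ = 𝟙 (crossing A a′ b′) * 𝟙 (B =ˢ move A a′ b′)
    other-source : ∀ a′ → a′ ≢ a → ∑[ b′ < n ] term a′ b′ ≡ 0
    other-source a′ a′≢a = ∑-zero λ b′ → move-term-vanishes A B a′ b′ λ c′ B≡′ →
      a′≢a (proj₁ (crossing-move-injective A c c′ (trans (sym B≡′) B≡)))
    other-target : ∀ b′ → b′ ≢ b → term a b′ ≡ 0
    other-target b′ b′≢b = move-term-vanishes A B a b′ λ c′ B≡′ →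
      b′≢b (proj₂ (crossing-move-injective A c c′ (trans (sym B≡′) B≡)))

  tokenNeighbour : Subset n → Subset n → Bool
  tokenNeighbour A B = (∣ B ∣ ≡ᵇ ∣ A ∣) ∧ tokenAdj G A B

  crossing⇒neighbour : ∀ A a b → crossing A a b ≡ true → tokenNeighbour A (move A a b) ≡ true
  crossing⇒neighbour A a b c =
    cong₂ _∧_ (Equivalence.to T-≡ (≡⇒≡ᵇ _ _ (crossing⇒∣move∣ A {a} {b} c)))
              (move⇒tokenAdj A (proj₂ (proj₂ (crossing⇒ A {a} {b} c))))

  neighbour-indicator : ∀ A B → 𝟙 (tokenNeighbour A B) ≡
                        ∑[ a < n ] ∑[ b < n ] (𝟙 (crossing A a b) * 𝟙 (B =ˢ move A a b))
  neighbour-indicator A B with tokenNeighbour A B in is-neighbour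
  ... | false = sym (∑-zero λ a → ∑-zero λ b → move-term-vanishes A B a b λ c B≡ →
    contradiction (trans (sym is-neighbour) (subst (λ X → tokenNeighbour A X ≡ true) (sym B≡) (crossing⇒neighbour A a b c)))
                  λ ())
  ... | true with ∧-true⇒ is-neighbour
  ...   | same-size , adjacent with tokenAdj⇒move A B adjacent
  ...     | a , b , ab , refl with ∣move∣≡⇒crossing A ab (≡ᵇ⇒≡ _ _ (Equivalence.from T-≡ same-size))
  ...       | inj₁ c = sym (move-terms-concentrated A _ c refl)
  ...       | inj₂ c = sym (move-terms-concentrated A _ c (move-comm A a b))

  tokenDegree≡crossings : ∀ A → tokenDegree G ∣ A ∣ A ≡ ∑[ a < n ] ∑[ b < n ] 𝟙 (crossing A a b)
  tokenDegree≡crossings A = trans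
    (countᵇ-by-pairs (tokenNeighbour A) (λ a b → 𝟙 (crossing A a b)) (λ a b → _=ˢ move A a b)
                     (neighbour-indicator A) (allSubsets n))
    (sum-cong-≗ λ a → sum-cong-≗ λ b →
      trans (cong (𝟙 (crossing A a b) *_) (countᵇ-allSubsets (move A a b))) (*-identityʳ _))

  degree≡∑ : ∀ a → degree G a ≡ ∑[ b < n ] 𝟙 (adj G a b)
  degree≡∑ a = countᵇ-tabulate (adj G a) (λ b → b)

  -- Vertex sets are Boolean predicates from here on, so that unions and complements are pointwise.
  degreeIn : (Fin n → Bool) → Fin n → ℕ
  degreeIn Y a = ∑[ b < n ] (𝟙 (Y b) * 𝟙 (adj G a b))

  edges : (Fin n → Bool) → (Fin n → Bool) → ℕ
  edges X Y = ∑[ a < n ] (𝟙 (X a) * degreeIn Y a)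

  cut : (Fin n → Bool) → ℕ
  cut X = edges X (not ∘ X)

  tokenDegree≡cut : ∀ A → tokenDegree G ∣ A ∣ A ≡ cut (lookup A)
  tokenDegree≡cut A = trans (tokenDegree≡crossings A) (sum-cong-≗ λ a →
    trans (sum-cong-≗ (factor a)) (sym (*-distribˡ-sum (𝟙 (lookup A a)) (leaving a))))
    where
    leaving : Fin n → Fin n → ℕ
    leaving a b = 𝟙 (not (lookup A b)) * 𝟙 (adj G a b)
    factor : ∀ a b → 𝟙 (crossing A a b) ≡ 𝟙 (lookup A a) * leaving a b
    factor a b = trans (𝟙-∧ (lookup A a) _) (cong (𝟙 (lookup A a) *_) (𝟙-∧ (not (lookup A b)) _))

  degree≡degreeIn-all : ∀ a → degree G a ≡ degreeIn (λ _ → true) a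
  degree≡degreeIn-all a = trans (degree≡∑ a) (sum-cong-≗ λ b → sym (*-identityˡ (𝟙 (adj G a b))))

  degreeIn≤degree : ∀ Y a → degreeIn Y a ≤ degree G a
  degreeIn≤degree Y a = subst (degreeIn Y a ≤_) (sym (degree≡∑ a)) (∑-mono-≤ λ b → 𝟙*≤ (Y b) _)
    where
    𝟙*≤ : ∀ y m → 𝟙 y * m ≤ m
    𝟙*≤ true  m = ≤-reflexive (*-identityˡ m)
    𝟙*≤ false m = z≤n

  degreeIn-cong : ∀ {Y Y′} → (∀ i → Y i ≡ Y′ i) → ∀ a → degreeIn Y a ≡ degreeIn Y′ a
  degreeIn-cong Y≗Y′ a = sum-cong-≗ λ b → cong (λ y → 𝟙 y * 𝟙 (adj G a b)) (Y≗Y′ b)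

  degreeIn-∪ : ∀ Y₁ Y₂ → (∀ i → Y₁ i ∧ Y₂ i ≡ false) → ∀ a →
               degreeIn (λ i → Y₁ i ∨ Y₂ i) a ≡ degreeIn Y₁ a + degreeIn Y₂ a
  degreeIn-∪ Y₁ Y₂ disjoint a = trans (sum-cong-≗ split)
    (∑-distrib-+ (λ b → 𝟙 (Y₁ b) * 𝟙 (adj G a b)) (λ b → 𝟙 (Y₂ b) * 𝟙 (adj G a b)))
    where
    split : ∀ b → 𝟙 (Y₁ b ∨ Y₂ b) * 𝟙 (adj G a b) ≡
                  𝟙 (Y₁ b) * 𝟙 (adj G a b) + 𝟙 (Y₂ b) * 𝟙 (adj G a b)
    split b = trans (cong (_* 𝟙 (adj G a b)) (𝟙-∨ (Y₁ b) (Y₂ b) (disjoint b)))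
                    (*-distribʳ-+ _ (𝟙 (Y₁ b)) _)

  degreeIn-⁅⁆ : ∀ w a → degreeIn (lookup ⁅ w ⁆) a ≡ 𝟙 (adj G a w)
  degreeIn-⁅⁆ w a = ∑-δ w (𝟙 ∘ adj G a)

  edges≡∑∑ : ∀ X Y → edges X Y ≡ ∑[ a < n ] ∑[ b < n ] (𝟙 (X a) * (𝟙 (Y b) * 𝟙 (adj G a b)))
  edges≡∑∑ X Y = sum-cong-≗ λ a → *-distribˡ-sum (𝟙 (X a)) (λ b → 𝟙 (Y b) * 𝟙 (adj G a b))

  edges-comm : ∀ X Y → edges X Y ≡ edges Y X
  edges-comm X Y = begin
    edges X Y
      ≡⟨ edges≡∑∑ X Y ⟩
    ∑[ a < n ] ∑[ b < n ] (𝟙 (X a) * (𝟙 (Y b) * 𝟙 (adj G a b)))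
      ≡⟨ ∑-comm (λ a b → 𝟙 (X a) * (𝟙 (Y b) * 𝟙 (adj G a b))) ⟩
    ∑[ b < n ] ∑[ a < n ] (𝟙 (X a) * (𝟙 (Y b) * 𝟙 (adj G a b)))
      ≡⟨ sum-cong-≗ (λ b → sum-cong-≗ (swap-ends b)) ⟩
    ∑[ b < n ] ∑[ a < n ] (𝟙 (Y b) * (𝟙 (X a) * 𝟙 (adj G b a)))
      ≡⟨ sym (edges≡∑∑ Y X) ⟩
    edges Y X ∎
    where
    open ≡-Reasoning
    swap-ends : ∀ b a → 𝟙 (X a) * (𝟙 (Y b) * 𝟙 (adj G a b)) ≡ 𝟙 (Y b) * (𝟙 (X a) * 𝟙 (adj G b a))
    swap-ends b a = trans (x∙yz≈y∙xz *-commutativeSemigroup (𝟙 (X a)) (𝟙 (Y b)) _)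
                          (cong (λ e → 𝟙 (Y b) * (𝟙 (X a) * 𝟙 e)) (symm G a b))

  edges-∪ˡ : ∀ X₁ X₂ Y → (∀ i → X₁ i ∧ X₂ i ≡ false) →
             edges (λ i → X₁ i ∨ X₂ i) Y ≡ edges X₁ Y + edges X₂ Y
  edges-∪ˡ X₁ X₂ Y disjoint = trans (sum-cong-≗ split)
    (∑-distrib-+ (λ a → 𝟙 (X₁ a) * degreeIn Y a) (λ a → 𝟙 (X₂ a) * degreeIn Y a))
    where
    split : ∀ a → 𝟙 (X₁ a ∨ X₂ a) * degreeIn Y a ≡ 𝟙 (X₁ a) * degreeIn Y a + 𝟙 (X₂ a) * degreeIn Y a
    split a = trans (cong (_* degreeIn Y a) (𝟙-∨ (X₁ a) (X₂ a) (disjoint a)))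
                    (*-distribʳ-+ _ (𝟙 (X₁ a)) _)

  edges-∪ʳ : ∀ X Y₁ Y₂ → (∀ i → Y₁ i ∧ Y₂ i ≡ false) →
             edges X (λ i → Y₁ i ∨ Y₂ i) ≡ edges X Y₁ + edges X Y₂
  edges-∪ʳ X Y₁ Y₂ disjoint = begin
    edges X (λ i → Y₁ i ∨ Y₂ i) ≡⟨ edges-comm X (λ i → Y₁ i ∨ Y₂ i) ⟩
    edges (λ i → Y₁ i ∨ Y₂ i) X ≡⟨ edges-∪ˡ Y₁ Y₂ X disjoint ⟩
    edges Y₁ X + edges Y₂ X     ≡⟨ cong₂ _+_ (edges-comm Y₁ X) (edges-comm Y₂ X) ⟩
    edges X Y₁ + edges X Y₂ ∎
    where open ≡-Reasoning

  edges-⁅⁆ˡ : ∀ u Y → edges (lookup ⁅ u ⁆) Y ≡ degreeIn Y u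
  edges-⁅⁆ˡ u Y = ∑-δ u (degreeIn Y)

  edges-congʳ : ∀ X {Y Y′} → (∀ i → Y i ≡ Y′ i) → edges X Y ≡ edges X Y′
  edges-congʳ X Y≗Y′ = sum-cong-≗ λ a → cong (𝟙 (X a) *_) (degreeIn-cong Y≗Y′ a)

  cut-cong : ∀ {X X′} → (∀ i → X i ≡ X′ i) → cut X ≡ cut X′
  cut-cong {X} {X′} X≗X′ = sum-cong-≗ λ a →
    cong₂ _*_ (cong 𝟙 (X≗X′ a)) (degreeIn-cong (cong not ∘ X≗X′) a)

  cut-insert : ∀ X u → X u ≡ false →
               cut (λ i → X i ∨ lookup ⁅ u ⁆ i) + 2 * degreeIn X u ≡ cut X + degree G u
  cut-insert X u u∉X = begin
    cut X⁺ + 2 * degreeIn X u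
      ≡⟨ cong (_+ 2 * degreeIn X u) cut-X⁺ ⟩
    (edges X R + degreeIn R u) + 2 * degreeIn X u
      ≡⟨ rearrange (edges X R) (degreeIn R u) (degreeIn X u) ⟩
    (edges X R + degreeIn X u) + (degreeIn X u + degreeIn R u)
      ≡⟨ sym (cong₂ _+_ cut-X degree-u) ⟩
    cut X + degree G u ∎
    where
    open ≡-Reasoning
    δ X⁺ R : Fin n → Bool
    δ = lookup ⁅ u ⁆
    X⁺ i = X i ∨ δ i
    R i = not (X⁺ i)
    X∩δ : ∀ i → X i ∧ δ i ≡ false
    X∩δ = ∉⇒disjoint-⁅⁆ X u∉X
    R∩δ : ∀ i → R i ∧ δ i ≡ false
    R∩δ i = excluded (X i) (δ i)
      where
      excluded : ∀ x d → not (x ∨ d) ∧ d ≡ false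
      excluded true  d = refl
      excluded false d = ∧-inverseˡ d
    not-X≗R∪δ : ∀ i → not (X i) ≡ R i ∨ δ i
    not-X≗R∪δ i = reinsert (X i) (δ i) (X∩δ i)
      where
      reinsert : ∀ x d → x ∧ d ≡ false → not x ≡ not (x ∨ d) ∨ d
      reinsert true  d d≡false = sym d≡false
      reinsert false d _       = sym (∨-inverseˡ d)
    rearrange : ∀ e r x → (e + r) + 2 * x ≡ (e + x) + (x + r)
    rearrange = solve-∀
    cut-X⁺ : cut X⁺ ≡ edges X R + degreeIn R u
    cut-X⁺ = trans (edges-∪ˡ X δ R X∩δ) (cong (edges X R +_) (edges-⁅⁆ˡ u R))
    cut-X : cut X ≡ edges X R + degreeIn X u
    cut-X = begin
      edges X (not ∘ X)          ≡⟨ edges-congʳ X not-X≗R∪δ ⟩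
      edges X (λ i → R i ∨ δ i)  ≡⟨ edges-∪ʳ X R δ R∩δ ⟩
      edges X R + edges X δ      ≡⟨ cong (edges X R +_) (trans (edges-comm X δ) (edges-⁅⁆ˡ u X)) ⟩
      edges X R + degreeIn X u ∎
    degree-X⁺ : degreeIn X⁺ u ≡ degreeIn X u
    degree-X⁺ = begin
      degreeIn X⁺ u
        ≡⟨ degreeIn-∪ X δ X∩δ u ⟩
      degreeIn X u + degreeIn δ u
        ≡⟨ cong (degreeIn X u +_) (trans (degreeIn-⁅⁆ u u) (cong 𝟙 (irrefl G u))) ⟩
      degreeIn X u + 0
        ≡⟨ +-identityʳ _ ⟩
      degreeIn X u ∎
    degree-u : degree G u ≡ degreeIn X u + degreeIn R u
    degree-u = begin
      degree G u                       ≡⟨ degree≡degreeIn-all u ⟩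
      degreeIn (λ _ → true) u          ≡⟨ degreeIn-cong (λ i → sym (∨-inverseʳ (X⁺ i))) u ⟩
      degreeIn (λ i → X⁺ i ∨ R i) u     ≡⟨ degreeIn-∪ X⁺ R (λ i → ∧-inverseʳ (X⁺ i)) u ⟩
      degreeIn X⁺ u + degreeIn R u      ≡⟨ cong (_+ degreeIn R u) degree-X⁺ ⟩
      degreeIn X u + degreeIn R u ∎

  cut-∪⁅⁆ : ∀ S {u} → lookup S u ≡ false →
            cut (lookup (S ∪ ⁅ u ⁆)) + 2 * degreeIn (lookup S) u ≡ cut (lookup S) + degree G u
  cut-∪⁅⁆ S {u} u∉S = trans (cong (_+ 2 * degreeIn (lookup S) u) (cut-cong (lookup-∪ S ⁅ u ⁆)))
                            (cut-insert (lookup S) u u∉S)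

  degreeIn-∪⁅⁆ : ∀ S {w} → lookup S w ≡ false → ∀ x →
                 degreeIn (lookup (S ∪ ⁅ w ⁆)) x ≡ degreeIn (lookup S) x + 𝟙 (adj G x w)
  degreeIn-∪⁅⁆ S {w} w∉S x = begin
    degreeIn (lookup (S ∪ ⁅ w ⁆)) x
      ≡⟨ degreeIn-cong (lookup-∪ S ⁅ w ⁆) x ⟩
    degreeIn (λ i → lookup S i ∨ lookup ⁅ w ⁆ i) x
      ≡⟨ degreeIn-∪ (lookup S) (lookup ⁅ w ⁆) (∉⇒disjoint-⁅⁆ (lookup S) w∉S) x ⟩
    degreeIn (lookup S) x + degreeIn (lookup ⁅ w ⁆) x
      ≡⟨ cong (degreeIn (lookup S) x +_) (degreeIn-⁅⁆ w x) ⟩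
    degreeIn (lookup S) x + 𝟙 (adj G x w) ∎
    where open ≡-Reasoning

  degree≥1 : ∀ {x y} → adj G x y ≡ true → 1 ≤ degree G x
  degree≥1 {x} {y} xy =
    subst (_≤ degree G x) (trans (degreeIn-⁅⁆ y x) (cong 𝟙 xy)) (degreeIn≤degree (lookup ⁅ y ⁆) x)

  degree≥2 : ∀ {x y z} → y ≢ z → adj G x y ≡ true → adj G x z ≡ true → 2 ≤ degree G x
  degree≥2 {x} {y} {z} y≢z xy xz =
    subst (_≤ degree G x) (trans (∑-pair y≢z (𝟙 ∘ adj G x)) (cong₂ (λ p q → 𝟙 p + 𝟙 q) xy xz))
          (degreeIn≤degree (λ i → lookup ⁅ y ⁆ i ∨ lookup ⁅ z ⁆ i) x)

-- Dominating pairs, stars and co-stars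

Dominates : Graph n → Fin n → Fin n → Set
Dominates {n} G u v = ∀ z → z ≢ u → z ≢ v → adj G u z ≡ true × adj G v z ≡ false

IsStarAt : Graph n → Fin n → Set
IsStarAt G x = (∀ y → y ≢ x → adj G x y ≡ true) × (∀ y z → y ≢ x → z ≢ x → adj G y z ≡ false)

IsCoStarAt : Graph n → Fin n → Set
IsCoStarAt G x = (∀ y → adj G x y ≡ false) × (∀ y z → y ≢ x → z ≢ x → y ≢ z → adj G y z ≡ true)

dominated-degree : ∀ (G : Graph n) {u v} → Dominates G u v → degree G v ≡ 𝟙 (adj G u v)
dominated-degree G {u} {v} dom =
  trans (degree≡∑ G v) (trans (∑-concentrated u vanish) (cong 𝟙 (symm G v u)))
  where
  vanish : ∀ z → z ≢ u → 𝟙 (adj G v z) ≡ 0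
  vanish z z≢u with z ≟ v
  ... | yes refl = cong 𝟙 (irrefl G z)
  ... | no  z≢v  = cong 𝟙 (proj₂ (dom z z≢u z≢v))

dominates⇒degreeIn : ∀ (G : Graph n) {u v} → Dominates G u v →
                     ∀ S → lookup S u ≡ false → lookup S v ≡ false →
                     degreeIn G (lookup S) u ≡ ∣ S ∣ × degreeIn G (lookup S) v ≡ 0
dominates⇒degreeIn G {u} {v} dom S u∉S v∉S =
  trans (sum-cong-≗ u-sees) (sym (∣p∣≡∑𝟙 S)) , ∑-zero v-misses
  where
  u-sees : ∀ z → 𝟙 (lookup S z) * 𝟙 (adj G u z) ≡ 𝟙 (lookup S z)
  u-sees z with lookup S z in z∈S
  ... | false = refl
  ... | true  = cong (λ e → 1 * 𝟙 e) (proj₁ (dom z (∈∉⇒≢ S z∈S u∉S) (∈∉⇒≢ S z∈S v∉S)))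
  v-misses : ∀ z → 𝟙 (lookup S z) * 𝟙 (adj G v z) ≡ 0
  v-misses z with lookup S z in z∈S
  ... | false = refl
  ... | true  = cong (λ e → 1 * 𝟙 e) (proj₂ (dom z (∈∉⇒≢ S z∈S u∉S) (∈∉⇒≢ S z∈S v∉S)))

dominating-degree : ∀ (G : Graph n) {u v} → Dominates G u v → u ≢ v →
                    degree G u + 2 ≡ n + 𝟙 (adj G u v)
dominating-degree {n} G {u} {v} dom u≢v = begin
  degree G u + 2
    ≡⟨ cong₂ _+_ (degree≡∑ G u) (sym (∑-pair u≢v (λ _ → 1))) ⟩
  ∑[ z < n ] 𝟙 (adj G u z) + ∑[ z < n ] (𝟙 (δu z ∨ δv z) * 1)
    ≡⟨ sym (∑-distrib-+ (𝟙 ∘ adj G u) (λ z → 𝟙 (δu z ∨ δv z) * 1)) ⟩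
  ∑[ z < n ] (𝟙 (adj G u z) + 𝟙 (δu z ∨ δv z) * 1)
    ≡⟨ sum-cong-≗ pointwise ⟩
  ∑[ z < n ] (1 + 𝟙 (δv z) * 𝟙 (adj G u v))
    ≡⟨ ∑-distrib-+ (λ _ → 1) (λ z → 𝟙 (δv z) * 𝟙 (adj G u v)) ⟩
  ∑[ z < n ] 1 + ∑[ z < n ] (𝟙 (δv z) * 𝟙 (adj G u v))
    ≡⟨ cong₂ _+_ (∑-one n) (∑-δ v (λ _ → 𝟙 (adj G u v))) ⟩
  n + 𝟙 (adj G u v) ∎
  where
  open ≡-Reasoning
  δu δv : Fin n → Bool
  δu = lookup ⁅ u ⁆
  δv = lookup ⁅ v ⁆
  pointwise : ∀ z → 𝟙 (adj G u z) + 𝟙 (δu z ∨ δv z) * 1 ≡ 1 + 𝟙 (δv z) * 𝟙 (adj G u v)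
  pointwise z with z ≟ u | z ≟ v
  ... | yes refl | yes refl = contradiction refl u≢v
  ... | yes refl | no  z≢v  rewrite irrefl G z | lookup-⁅⁆-self z | lookup-⁅⁆-≢ z≢v = refl
  ... | no  z≢u  | yes refl rewrite lookup-⁅⁆-≢ z≢u | lookup-⁅⁆-self z =
    trans (+-comm (𝟙 (adj G u z)) 1) (cong suc (sym (+-identityʳ _)))
  ... | no  z≢u  | no  z≢v  rewrite lookup-⁅⁆-≢ z≢u | lookup-⁅⁆-≢ z≢v | proj₁ (dom z z≢u z≢v) = refl

permutation-injective : ∀ (π : Permutation′ n) {i j} → π ⟨$⟩ʳ i ≡ π ⟨$⟩ʳ j → i ≡ j
permutation-injective π = Injection.injective (Inverse⇒Injection π)

transpose-zero-suc≢ : ∀ (x : Fin (suc n)) i → transpose zero x ⟨$⟩ʳ suc i ≢ x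
transpose-zero-suc≢ x i eq with () ← permutation-injective (transpose zero x) {suc i} {zero} eq

IsStarAt⇒≅star : ∀ (G : Graph n) x → IsStarAt G x → G ≅ star n
IsStarAt⇒≅star {suc n} G x (centre , leaves) = transpose zero x , relabel
  where
  π = transpose zero x
  relabel : ∀ i j → adj G (π ⟨$⟩ʳ i) (π ⟨$⟩ʳ j) ≡ starAdj i j
  relabel zero    zero    = irrefl G x
  relabel zero    (suc j) = centre _ (transpose-zero-suc≢ x j)
  relabel (suc i) zero    = trans (symm G _ x) (centre _ (transpose-zero-suc≢ x i))
  relabel (suc i) (suc j) = leaves _ _ (transpose-zero-suc≢ x i) (transpose-zero-suc≢ x j)

IsCoStarAt⇒≅complement-star : ∀ (G : Graph n) x → IsCoStarAt G x → G ≅ complement (star n)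
IsCoStarAt⇒≅complement-star {suc n} G x (isolated , complete) = transpose zero x , relabel
  where
  π = transpose zero x
  relabel : ∀ i j → adj G (π ⟨$⟩ʳ i) (π ⟨$⟩ʳ j) ≡ adj (complement (star (suc n))) i j
  relabel zero    zero    = irrefl G x
  relabel zero    (suc j) = isolated _
  relabel (suc i) zero    = trans (symm G _ x) (isolated _)
  relabel (suc i) (suc j) with suc i ≟ suc j
  ... | yes refl = irrefl G _
  ... | no  i≢j  =
    complete _ _ (transpose-zero-suc≢ x i) (transpose-zero-suc≢ x j) (i≢j ∘ permutation-injective π)

-- Regularity of the token graph

+-cross : ∀ a c x y x′ y′ → a + x ≡ c + y → a + x′ ≡ c + y′ → y + x′ ≡ y′ + x
+-cross a c x y x′ y′ e e′ = +-cancelˡ-≡ (a + c) _ _ (begin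
  (a + c) + (y + x′)  ≡⟨ regroup a c y x′ ⟩
  (c + y) + (a + x′)  ≡⟨ cong₂ _+_ (sym e) e′ ⟩
  (a + x) + (c + y′)  ≡⟨ regroup′ a x c y′ ⟩
  (a + c) + (y′ + x) ∎)
  where
  open ≡-Reasoning
  regroup : ∀ a c y x′ → (a + c) + (y + x′) ≡ (c + y) + (a + x′)
  regroup = solve-∀
  regroup′ : ∀ a x c y′ → (a + x) + (c + y′) ≡ (a + c) + (y′ + x)
  regroup′ = solve-∀

-- k = 2 + m, and the regularity of F_k(G) is given through tokenDegree≡cut.
module RegularTokenGraph (G : Graph n) (m d : ℕ)
         (cut-constant : ∀ S → ∣ S ∣ ≡ 2 + m → cut G (lookup S) ≡ d)
         (room : 2 + m + 2 ≤ n) where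

  room-for-pair : suc m + 2 ≤ n
  room-for-pair = ≤-trans (n≤1+n _) room

  room-for-four : m + 4 ≤ n
  room-for-four = subst (_≤ n) (sym (trans (+-suc m 3) (cong suc (+-suc m 2)))) room

  balance : ∀ S {u v} → ∣ S ∣ ≡ suc m → lookup S u ≡ false → lookup S v ≡ false →
            degree G u + 2 * degreeIn G (lookup S) v ≡ degree G v + 2 * degreeIn G (lookup S) u
  balance S {u} {v} ∣S∣ u∉S v∉S =
    +-cross d (cut G (lookup S)) (2 * eS u) (degree G u) (2 * eS v) (degree G v)
            (inserting u∉S) (inserting v∉S)
    where
    eS : Fin n → ℕ
    eS = degreeIn G (lookup S)
    inserting : ∀ {w} → lookup S w ≡ false → d + 2 * eS w ≡ cut G (lookup S) + degree G w
    inserting {w} w∉S = trans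
      (cong (_+ 2 * eS w)
            (sym (cut-constant (S ∪ ⁅ w ⁆) (trans (∣p∪⁅x⁆∣≡1+∣p∣ S w∉S) (cong suc ∣S∣)))))
      (cut-∪⁅⁆ G S w∉S)

  avoiding-pair : ∀ u v → ∃ λ S → ∣ S ∣ ≡ suc m × lookup S u ≡ false × lookup S v ≡ false
  avoiding-pair u v
    with S , ∣S∣ , avoids ← ∃-avoiding (suc m) (⁅ u ⁆ ∪ ⁅ v ⁆)
                              (≤-trans (+-monoʳ-≤ (suc m) (∣⁅u⁆∪⁅v⁆∣≤2 u v)) room-for-pair)
    = S , ∣S∣ , avoids u (∪-∋ˡ ⁅ u ⁆ ⁅ v ⁆ (lookup-⁅⁆-self u))
              , avoids v (∪-∋ʳ ⁅ u ⁆ ⁅ v ⁆ (lookup-⁅⁆-self v))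

  avoiding-four : ∀ u v w w′ → ∃ λ T → ∣ T ∣ ≡ m ×
                  lookup T u ≡ false × lookup T v ≡ false × lookup T w ≡ false × lookup T w′ ≡ false
  avoiding-four u v w w′
    with T , ∣T∣ , avoids ← ∃-avoiding m (⁅ u ⁆ ∪ ⁅ v ⁆ ∪ ⁅ w ⁆ ∪ ⁅ w′ ⁆)
                              (≤-trans (+-monoʳ-≤ m (∣⁅u⁆∪⁅v⁆∪⁅w⁆∪⁅w′⁆∣≤4 u v w w′)) room-for-four)
    = T , ∣T∣ , avoids u (∪-∋ˡ ⁅ u ⁆ _ (lookup-⁅⁆-self u))
              , avoids v (∪-∋ʳ ⁅ u ⁆ _ (∪-∋ˡ ⁅ v ⁆ _ (lookup-⁅⁆-self v)))
              , avoids w (∪-∋ʳ ⁅ u ⁆ _ (∪-∋ʳ ⁅ v ⁆ _ (∪-∋ˡ ⁅ w ⁆ _ (lookup-⁅⁆-self w))))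
              , avoids w′ (∪-∋ʳ ⁅ u ⁆ _ (∪-∋ʳ ⁅ v ⁆ _ (∪-∋ʳ ⁅ w ⁆ _ (lookup-⁅⁆-self w′))))

  swap-balance : ∀ {u v w w′} → w ≢ w′ → w ≢ u → w ≢ v → w′ ≢ u → w′ ≢ v →
                 𝟙 (adj G u w) + 𝟙 (adj G v w′) ≡ 𝟙 (adj G v w) + 𝟙 (adj G u w′)
  swap-balance {u} {v} {w} {w′} w≢w′ w≢u w≢v w′≢u w′≢v
    with T , ∣T∣ , u∉T , v∉T , w∉T , w′∉T ← avoiding-four u v w w′
    = trans (*-cancelˡ-≡ _ _ 2 doubled) (+-comm (𝟙 (adj G u w′)) _)
    where
    eT : Fin n → ℕ
    eT = degreeIn G (lookup T)
    inserting : ∀ {x} → lookup T x ≡ false → x ≢ u → x ≢ v →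
                (degree G u + 2 * eT v) + 2 * 𝟙 (adj G v x) ≡
                (degree G v + 2 * eT u) + 2 * 𝟙 (adj G u x)
    inserting {x} x∉T x≢u x≢v = begin
      (degree G u + 2 * eT v) + 2 * 𝟙 (adj G v x)
        ≡⟨ regroup (degree G u) (eT v) _ ⟩
      degree G u + 2 * (eT v + 𝟙 (adj G v x))
        ≡⟨ cong (λ e → degree G u + 2 * e) (sym (degreeIn-∪⁅⁆ G T x∉T v)) ⟩
      degree G u + 2 * degreeIn G (lookup (T ∪ ⁅ x ⁆)) v
        ≡⟨ balance (T ∪ ⁅ x ⁆) (trans (∣p∪⁅x⁆∣≡1+∣p∣ T x∉T) (cong suc ∣T∣))
                   (∪⁅⁆-∌ T u∉T (x≢u ∘ sym)) (∪⁅⁆-∌ T v∉T (x≢v ∘ sym)) ⟩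
      degree G v + 2 * degreeIn G (lookup (T ∪ ⁅ x ⁆)) u
        ≡⟨ cong (λ e → degree G v + 2 * e) (degreeIn-∪⁅⁆ G T x∉T u) ⟩
      degree G v + 2 * (eT u + 𝟙 (adj G u x))
        ≡⟨ sym (regroup (degree G v) (eT u) _) ⟩
      (degree G v + 2 * eT u) + 2 * 𝟙 (adj G u x) ∎
      where
      open ≡-Reasoning
      regroup : ∀ a e b → (a + 2 * e) + 2 * b ≡ a + 2 * (e + b)
      regroup = solve-∀
    doubled : 2 * (𝟙 (adj G u w) + 𝟙 (adj G v w′)) ≡ 2 * (𝟙 (adj G u w′) + 𝟙 (adj G v w))
    doubled = trans (*-distribˡ-+ 2 (𝟙 (adj G u w)) _)
      (trans (+-cross (degree G u + 2 * eT v) (degree G v + 2 * eT u)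
                      (2 * 𝟙 (adj G v w)) (2 * 𝟙 (adj G u w))
                      (2 * 𝟙 (adj G v w′)) (2 * 𝟙 (adj G u w′))
                      (inserting w∉T w≢u w≢v) (inserting w′∉T w′≢u w′≢v))
             (sym (*-distribˡ-+ 2 (𝟙 (adj G u w′)) _)))

  disagreement⇒dominates : ∀ {u v z} → z ≢ u → z ≢ v → adj G u z ≡ true → adj G v z ≡ false →
                           Dominates G u v
  disagreement⇒dominates {u} {v} {z} z≢u z≢v uz vz y y≢u y≢v with y ≟ z
  ... | yes refl = uz , vz
  ... | no  y≢z  = forced (adj G u y) (adj G v y)
    (subst₂ (λ p q → 𝟙 p + 𝟙 (adj G v y) ≡ 𝟙 q + 𝟙 (adj G u y)) uz vz
            (swap-balance (y≢z ∘ sym) z≢u z≢v y≢u y≢v))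
    where
    forced : ∀ p q → 1 + 𝟙 q ≡ 0 + 𝟙 p → p ≡ true × q ≡ false
    forced true  false _ = refl , refl
    forced true  true  ()
    forced false _     ()

  agreement⇒equal-degrees : ∀ {u v} → (∀ z → z ≢ u → z ≢ v → adj G u z ≡ adj G v z) →
                            degree G u ≡ degree G v
  agreement⇒equal-degrees {u} {v} agree
    with S , ∣S∣ , u∉S , v∉S ← avoiding-pair u v
    = +-cancelʳ-≡ (2 * degreeIn G (lookup S) u) _ _
        (subst (λ e → degree G u + 2 * e ≡ degree G v + 2 * degreeIn G (lookup S) u)
               (degreeIn-agree S u∉S v∉S) (balance S ∣S∣ u∉S v∉S))
    where
    degreeIn-agree : ∀ S → lookup S u ≡ false → lookup S v ≡ false →
                     degreeIn G (lookup S) v ≡ degreeIn G (lookup S) u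
    degreeIn-agree S u∉S v∉S = sum-cong-≗ pointwise
      where
      pointwise : ∀ z → 𝟙 (lookup S z) * 𝟙 (adj G v z) ≡ 𝟙 (lookup S z) * 𝟙 (adj G u z)
      pointwise z with lookup S z in z∈S
      ... | false = refl
      ... | true  = cong (λ e → 1 * 𝟙 e) (sym (agree z (∈∉⇒≢ S z∈S u∉S) (∈∉⇒≢ S z∈S v∉S)))

  unequal-degrees⇒dominates : ∀ {u v} → degree G u ≢ degree G v → Dominates G u v ⊎ Dominates G v u
  unequal-degrees⇒dominates {u} {v} du≢dv
    with any? (λ z → ¬? (z ≟ u) ×-dec ¬? (z ≟ v) ×-dec ¬? (adj G u z ≟ᵇ adj G v z))
  ... | no ¬disagreement = contradiction (agreement⇒equal-degrees agree) du≢dv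
    where
    agree : ∀ z → z ≢ u → z ≢ v → adj G u z ≡ adj G v z
    agree z z≢u z≢v =
      decidable-stable (adj G u z ≟ᵇ adj G v z) λ differ → ¬disagreement (z , z≢u , z≢v , differ)
  ... | yes (z , z≢u , z≢v , differ) with adj G u z in uz | adj G v z in vz
  ...   | true  | false = inj₁ (disagreement⇒dominates z≢u z≢v uz vz)
  ...   | false | true  = inj₂ (disagreement⇒dominates z≢v z≢u vz uz)
  ...   | true  | true  = contradiction refl differ
  ...   | false | false = contradiction refl differ

  larger-degree⇒dominates : ∀ {y v} → degree G v < degree G y → Dominates G y v ⊎ Dominates G v y
  larger-degree⇒dominates dv<dy = unequal-degrees⇒dominates (≢-sym (<⇒≢ dv<dy))

  dominates⇒2k≡n : ∀ {u v} → Dominates G u v → u ≢ v → 2 * (2 + m) ≡ n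
  dominates⇒2k≡n {u} {v} dom u≢v
    with S , ∣S∣ , u∉S , v∉S ← avoiding-pair u v
    with u-sees-S , v-misses-S ← dominates⇒degreeIn G dom S u∉S v∉S
    = conclude (degree G u) (𝟙 (adj G u v)) degree-u (dominating-degree G dom u≢v)
    where
    open ≡-Reasoning
    degree-u : degree G u ≡ 𝟙 (adj G u v) + 2 * suc m
    degree-u = begin
      degree G u
        ≡⟨ sym (+-identityʳ _) ⟩
      degree G u + 2 * 0
        ≡⟨ cong (λ e → degree G u + 2 * e) (sym v-misses-S) ⟩
      degree G u + 2 * degreeIn G (lookup S) v
        ≡⟨ balance S ∣S∣ u∉S v∉S ⟩
      degree G v + 2 * degreeIn G (lookup S) u
        ≡⟨ cong₂ (λ a b → a + 2 * b) (dominated-degree G dom) (trans u-sees-S ∣S∣) ⟩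
      𝟙 (adj G u v) + 2 * suc m ∎
    conclude : ∀ du c → du ≡ c + 2 * suc m → du + 2 ≡ n + c → 2 * (2 + m) ≡ n
    conclude du c refl e = +-cancelˡ-≡ c _ _ (trans (rearrange c m) (trans e (+-comm n c)))
      where
      rearrange : ∀ c m → c + 2 * (2 + m) ≡ (c + 2 * suc m) + 2
      rearrange = solve-∀

  dominates-adjacent⇒star : ∀ {u v} → Dominates G u v → adj G u v ≡ true → IsStarAt G u
  dominates-adjacent⇒star {u} {v} dom uv = centre , leaves
    where
    centre : ∀ y → y ≢ u → adj G u y ≡ true
    centre y y≢u with y ≟ v
    ... | yes refl = uv
    ... | no  y≢v  = proj₁ (dom y y≢u y≢v)
    v-is-leaf : ∀ z → z ≢ u → adj G v z ≡ false
    v-is-leaf z z≢u with z ≟ v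
    ... | yes refl = irrefl G z
    ... | no  z≢v  = proj₂ (dom z z≢u z≢v)
    v-has-degree-1 : degree G v ≡ 1
    v-has-degree-1 = trans (dominated-degree G dom) (cong 𝟙 uv)
    v<y : ∀ {y z} → y ≢ u → z ≢ u → adj G y z ≡ true → degree G v < degree G y
    v<y {y} y≢u z≢u yz = subst (_< degree G y) (sym v-has-degree-1)
                               (degree≥2 G (z≢u ∘ sym) (trans (symm G y u) (centre y y≢u)) yz)
    others-independent : ∀ y z → y ≢ u → y ≢ v → z ≢ u → z ≢ v → y ≢ z → adj G y z ≡ false
    others-independent y z y≢u y≢v z≢u z≢v y≢z with adj G y z in yz
    ... | false = refl
    ... | true with larger-degree⇒dominates (v<y y≢u z≢u yz)
    ...   | inj₁ y-dom-v = trans (sym (trans (symm G v u) uv)) (proj₂ (y-dom-v u (y≢u ∘ sym) (adj⇒≢ G uv)))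
    ...   | inj₂ v-dom-y = trans (sym (proj₁ (v-dom-y z z≢v (y≢z ∘ sym)))) (v-is-leaf z z≢u)
    leaves : ∀ y z → y ≢ u → z ≢ u → adj G y z ≡ false
    leaves y z y≢u z≢u with y ≟ v | z ≟ v
    ... | yes refl | _        = v-is-leaf z z≢u
    ... | no  _    | yes refl = trans (symm G y z) (v-is-leaf y y≢u)
    ... | no  y≢v  | no  z≢v  with y ≟ z
    ...   | yes refl = irrefl G y
    ...   | no  y≢z  = others-independent y z y≢u y≢v z≢u z≢v y≢z

  dominates-nonadjacent⇒costar : ∀ {u v} → Dominates G u v → u ≢ v → adj G u v ≡ false →
                                 IsCoStarAt G v
  dominates-nonadjacent⇒costar {u} {v} dom u≢v uv = isolated , complete
    where
    isolated : ∀ y → adj G v y ≡ false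
    isolated y with y ≟ v | y ≟ u
    ... | yes refl | _        = irrefl G y
    ... | no  _    | yes refl = trans (symm G v y) uv
    ... | no  y≢v  | no  y≢u  = proj₂ (dom y y≢u y≢v)
    v-has-degree-0 : degree G v ≡ 0
    v-has-degree-0 = trans (dominated-degree G dom) (cong 𝟙 uv)
    v<y : ∀ {y} → y ≢ u → y ≢ v → degree G v < degree G y
    v<y {y} y≢u y≢v = subst (_< degree G y) (sym v-has-degree-0)
                            (degree≥1 G (trans (symm G y u) (proj₁ (dom y y≢u y≢v))))
    others-adjacent : ∀ y z → y ≢ u → y ≢ v → z ≢ v → y ≢ z → adj G y z ≡ true
    others-adjacent y z y≢u y≢v z≢v y≢z with larger-degree⇒dominates (v<y y≢u y≢v)
    ... | inj₁ y-dom-v = proj₁ (y-dom-v z (y≢z ∘ sym) z≢v)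
    ... | inj₂ v-dom-y = contradiction (trans (sym (proj₁ (v-dom-y u u≢v (y≢u ∘ sym)))) (isolated u)) λ ()
    complete : ∀ y z → y ≢ v → z ≢ v → y ≢ z → adj G y z ≡ true
    complete y z y≢v z≢v y≢z with y ≟ u | z ≟ u
    ... | yes refl | _        = proj₁ (dom z (y≢z ∘ sym) z≢v)
    ... | no  _    | yes refl = trans (symm G y z) (proj₁ (dom y y≢z y≢v))
    ... | no  y≢u  | no  _    = others-adjacent y z y≢u y≢v z≢v y≢z

  dominates⇒conclusion : ∀ {u v} → Dominates G u v → u ≢ v →
                         ((G ≅ star n) ⊎ (G ≅ complement (star n))) × (2 * (2 + m) ≡ n)
  dominates⇒conclusion {u} {v} dom u≢v = isomorphic , dominates⇒2k≡n dom u≢v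
    where
    isomorphic : (G ≅ star n) ⊎ (G ≅ complement (star n))
    isomorphic with adj G u v in uv
    ... | true  = inj₁ (IsStarAt⇒≅star G u (dominates-adjacent⇒star dom uv))
    ... | false = inj₂ (IsCoStarAt⇒≅complement-star G v (dominates-nonadjacent⇒costar dom u≢v uv))

  unequal-degrees⇒conclusion : ∀ {u v} → degree G u ≢ degree G v →
                               ((G ≅ star n) ⊎ (G ≅ complement (star n))) × (2 * (2 + m) ≡ n)
  unequal-degrees⇒conclusion du≢dv with unequal-degrees⇒dominates du≢dv
  ... | inj₁ u-dom-v = dominates⇒conclusion u-dom-v λ { refl → du≢dv refl }
  ... | inj₂ v-dom-u = dominates⇒conclusion v-dom-u λ { refl → du≢dv refl }

¬regular⇒unequal-degrees : ∀ (G : Graph n) → ¬ IsRegular G → Fin n →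
                           ∃₂ λ u v → degree G u ≢ degree G v
¬regular⇒unequal-degrees {n} G ¬regular v with all? (λ u → degree G u ≟ℕ degree G v)
... | yes all-equal = contradiction (degree G v , all-equal) ¬regular
... | no  ¬all-equal with u , du≢dv ← ¬∀⟶∃¬ n _ (λ u → degree G u ≟ℕ degree G v) ¬all-equal
  = u , v , du≢dv

theorem4 : ∀ {n} (G : Graph n) (k : ℕ) → ¬ IsRegular G → 2 ≤ k → k + 2 ≤ n →
    TokenRegular G k →
    ((G ≅ star n) ⊎ (G ≅ complement (star n))) × (2 * k ≡ n)
theorem4 G (suc (suc m)) ¬regular (s≤s (s≤s z≤n)) room (d , regular) =
  unequal-degrees⇒conclusion (proj₂ (proj₂ (¬regular⇒unequal-degrees G ¬regular some-vertex)))
  where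
  cut-constant : ∀ S → ∣ S ∣ ≡ 2 + m → cut G (lookup S) ≡ d
  cut-constant S ∣S∣ =
    trans (sym (tokenDegree≡cut G S)) (trans (cong (λ k → tokenDegree G k S) ∣S∣) (regular S ∣S∣))
  open RegularTokenGraph G m d cut-constant room
  some-vertex = fromℕ< (≤-trans (s≤s z≤n) room)
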